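{- For all natural numbers $k\geq 0$ and $n\geq 0$ and every $i$ with $0\leq i\leq n$, the clause $f(x_{k+1})=i,\ f(m(k,x,s(x_{k+1})))=i\ \vdash$ is derivable by resolution from $C(n)$.
   Context: Work in a first-order language with a constant $0$, unary function symbols $s$ and $f$, a binary function symbol $\max$, a binary predicate symbol $\leq$, and atoms of the form $f(t)=k$ where $t$ is a term and $k$ is a numeral; here $=$ is an uninterpreted binary predicate (no equality axioms). A clause is a sequent $\Pi \vdash \Delta$ of finite multisets of atoms; its variables are implicitly universally quantified. For $n\ge 0$, $C(n)$ consists of, with variables $\alpha,\beta,\gamma$: (C1) $\vdash \alpha \leq \alpha$; (C2) $\max(\alpha,\beta)\leq\gamma \vdash \alpha\leq\gamma$; (C3) $\max(\alpha,\beta)\leq\gamma \vdash \beta\leq\gamma$; (C4$(k)$) $f(\beta)=k,\ f(\alpha)=k,\ s(\beta)\leq\alpha \vdash$ for each $0\le k\le n$; (C5) $\vdash f(\alpha)=0,\ldots, f(\alpha)=n$. A clause is derivable by resolution from $C(n)$ if it is obtained in finitely many steps from variable-renamed copies of clauses of $C(n)$ by the resolution rule (from $\Pi\vdash P,\Delta$ and $\Pi',P'\vdash\Delta'$ and a substitution $\sigma$ with $P\sigma=P'\sigma$, infer $\Pi\sigma,\Pi'\sigma\vdash\Delta\sigma,\Delta'\sigma$) and contraction (merging identical atoms on one side). Let $x_1,x_2,\ldots$ be variables. The term $m(k,x,t)$ is defined by $m(0,x,t)=t$ and $m(k+1,x,t)=m(k,x,\max(s(x_{k+1}),t))$; explicitly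 $m(k,x,t)=\max(s(x_1),\max(s(x_2),\ldots,\max(s(x_k),t)\ldots))$, so $m(k,x,s(x_{k+1}))=\max(s(x_1),\ldots,\max(s(x_k),s(x_{k+1}))\ldots)$. -}

module Defs where

open import Data.Nat using (ℕ; zero; suc; _≤_)
open import Data.List using (List; []; _∷_; _++_; map; upTo)
open import Data.List.Relation.Binary.Permutation.Propositional using (_↭_)
open import Relation.Binary.PropositionalEquality using (_≡_)
open import Function.Definitions using (Injective)

-- Variables are natural numbers: var j.  The variable x_j of the paper is var j (j ≥ 1).
-- In C(n) we use α = var 0, β = var 1, γ = var 2.

data Term : Set where
  var  : ℕ → Term
  𝟘    : Term
  s    : Term → Term
  f    : Term → Term
  max  : Term → Term → Term

-- Atoms: t ≤ u, and  t ≐ k  standing for the atom "t = k" with k a numeral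
-- (in this language t is always of the form f(t')).
data Atom : Set where
  _≤ₐ_ : Term → Term → Atom
  _≐_  : Term → ℕ → Atom

Subst : Set
Subst = ℕ → Term

subT : Subst → Term → Term
subT σ (var x)   = σ x
subT σ 𝟘         = 𝟘
subT σ (s t)     = s (subT σ t)
subT σ (f t)     = f (subT σ t)
subT σ (max t u) = max (subT σ t) (subT σ u)

subA : Subst → Atom → Atom
subA σ (t ≤ₐ u) = subT σ t ≤ₐ subT σ u
subA σ (t ≐ k)  = subT σ t ≐ k

subL : Subst → List Atom → List Atom
subL σ = map (subA σ)

-- A clause (sequent) Π ⊢ Δ; lists are read as multisets (see the exchange rule).
record Clause : Set where
  constructor _⊢_
  field
    ante : List Atom
    succ : List Atom

subC : Subst → Clause → Clause
subC σ (Π ⊢ Δ) = subL σ Π ⊢ subL σ Δ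

renC : (ℕ → ℕ) → Clause → Clause
renC ρ = subC (λ x → var (ρ x))

α β γ : Term
α = var 0
β = var 1
γ = var 2

data C (n : ℕ) : Clause → Set where
  C1 : C n ([] ⊢ (α ≤ₐ α ∷ []))
  C2 : C n ((max α β ≤ₐ γ ∷ []) ⊢ (α ≤ₐ γ ∷ []))
  C3 : C n ((max α β ≤ₐ γ ∷ []) ⊢ (β ≤ₐ γ ∷ []))
  C4 : (k : ℕ) → k ≤ n →
       C n ((f β ≐ k ∷ f α ≐ k ∷ s β ≤ₐ α ∷ []) ⊢ [])
  C5 : C n ([] ⊢ map (λ k → f α ≐ k) (upTo (suc n)))

data Derivable (n : ℕ) : Clause → Set where
  axiom   : ∀ {D} → C n D → (ρ : ℕ → ℕ) → Injective _≡_ _≡_ ρ →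
            Derivable n (renC ρ D)
  exchange : ∀ {Π Π′ Δ Δ′} → Derivable n (Π ⊢ Δ) → Π ↭ Π′ → Δ ↭ Δ′ →
             Derivable n (Π′ ⊢ Δ′)
  resolve : ∀ {Π Δ Π′ Δ′ P P′} (σ : Subst) →
            Derivable n (Π ⊢ (P ∷ Δ)) → Derivable n ((P′ ∷ Π′) ⊢ Δ′) →
            subA σ P ≡ subA σ P′ →
            Derivable n ((subL σ Π ++ subL σ Π′) ⊢ (subL σ Δ ++ subL σ Δ′))
  contrˡ  : ∀ {A Π Δ} → Derivable n ((A ∷ A ∷ Π) ⊢ Δ) → Derivable n ((A ∷ Π) ⊢ Δ)
  contrʳ  : ∀ {A Π Δ} → Derivable n (Π ⊢ (A ∷ A ∷ Δ)) → Derivable n (Π ⊢ (A ∷ Δ))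

x : ℕ → Term
x j = var j

m : ℕ → Term → Term
m zero    t = t
m (suc k) t = m k (max (s (x (suc k))) t)

-- Every clause needed is the resolvent of a derived unit clause ⊢ A with a
-- renamed-apart copy of an axiom: rename the axiom's variables above those of
-- A and let the unifier act on the two blocks of variables separately.
-- Resolving ⊢ α ≤ α against C3 gives ⊢ t ≤ max(a, t), and each further
-- resolution with C3 strips one maximum from the left, so by induction
-- ⊢ t ≤ m(k, x, max(a, t)); in particular ⊢ s(x_{k+1}) ≤ m(k, x, s(x_{k+1})),
-- and one resolution with C4(i) turns this into the claimed clause.
module Submission where

open import Defs
open import Data.Nat using (ℕ; zero; suc; _+_; _∸_; _≤_; _<_; _<?_; s≤s; z≤n)
open import Data.Nat.Properties using (+-cancelˡ-≡; m+n≮m; m+n∸m≡n; <-trans; n<1+n; m<n⇒m<1+n)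
open import Data.List using ([]; _∷_)
open import Data.List.Relation.Binary.Permutation.Propositional using (_↭_; ↭-refl)
open import Data.List.Relation.Binary.Permutation.Propositional.Properties using (map⁺; shift)
open import Data.Product using (_×_; _,_)
open import Data.Unit using (⊤)
open import Data.Empty using (⊥-elim)
open import Relation.Nullary using (yes; no)
open import Relation.Binary.PropositionalEquality using (_≡_; refl; sym; trans; cong; cong₂; subst)

VarsBelow : ℕ → Term → Set
VarsBelow N (var j)   = j < N
VarsBelow N 𝟘         = ⊤
VarsBelow N (s t)     = VarsBelow N t
VarsBelow N (f t)     = VarsBelow N t
VarsBelow N (max t u) = VarsBelow N t × VarsBelow N u

VarsBelowₐ : ℕ → Atom → Set
VarsBelowₐ N (t ≤ₐ u) = VarsBelow N t × VarsBelow N u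
VarsBelowₐ N (t ≐ k)  = VarsBelow N t

VarsBelow-m : ∀ {N} k t → k < N → VarsBelow N t → VarsBelow N (m k t)
VarsBelow-m zero    t k<N t<N = t<N
VarsBelow-m (suc k) t k<N t<N =
  VarsBelow-m k (max (s (x (suc k))) t) (<-trans (n<1+n k) k<N) (k<N , t<N)

subT-var : ∀ t → subT var t ≡ t
subT-var (var j)   = refl
subT-var 𝟘         = refl
subT-var (s t)     = cong s (subT-var t)
subT-var (f t)     = cong f (subT-var t)
subT-var (max t u) = cong₂ max (subT-var t) (subT-var u)

subA-var : ∀ A → subA var A ≡ A
subA-var (t ≤ₐ u) = cong₂ _≤ₐ_ (subT-var t) (subT-var u)
subA-var (t ≐ k)  = cong (_≐ k) (subT-var t)

raise : ℕ → Subst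
raise N v = var (N + v)

split : ℕ → Subst → Subst → Subst
split N h g j with j <? N
... | yes _ = h j
... | no  _ = g (j ∸ N)

split-below : ∀ N h g {j} → j < N → split N h g j ≡ h j
split-below N h g {j} j<N with j <? N
... | yes _  = refl
... | no j≮N = ⊥-elim (j≮N j<N)

split-raise : ∀ N h g v → split N h g (N + v) ≡ g v
split-raise N h g v with N + v <? N
... | yes N+v<N = ⊥-elim (m+n≮m N v N+v<N)
... | no  _     = cong g (m+n∸m≡n N v)

module _ (N : ℕ) (h g : Subst) where

  subT-split-below : ∀ t → VarsBelow N t → subT (split N h g) t ≡ subT h t
  subT-split-below (var j)   j<N         = split-below N h g j<N
  subT-split-below 𝟘         _           = refl
  subT-split-below (s t)     t<N         = cong s (subT-split-below t t<N)
  subT-split-below (f t)     t<N         = cong f (subT-split-below t t<N)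
  subT-split-below (max t u) (t<N , u<N) =
    cong₂ max (subT-split-below t t<N) (subT-split-below u u<N)

  subA-split-below : ∀ A → VarsBelowₐ N A → subA (split N h g) A ≡ subA h A
  subA-split-below (t ≤ₐ u) (t<N , u<N) =
    cong₂ _≤ₐ_ (subT-split-below t t<N) (subT-split-below u u<N)
  subA-split-below (t ≐ k)  t<N = cong (_≐ k) (subT-split-below t t<N)

  subT-split-raise : ∀ t → subT (split N h g) (subT (raise N) t) ≡ subT g t
  subT-split-raise (var v)   = split-raise N h g v
  subT-split-raise 𝟘         = refl
  subT-split-raise (s t)     = cong s (subT-split-raise t)
  subT-split-raise (f t)     = cong f (subT-split-raise t)
  subT-split-raise (max t u) = cong₂ max (subT-split-raise t) (subT-split-raise u)

  subA-split-raise : ∀ A → subA (split N h g) (subA (raise N) A) ≡ subA g A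
  subA-split-raise (t ≤ₐ u) = cong₂ _≤ₐ_ (subT-split-raise t) (subT-split-raise u)
  subA-split-raise (t ≐ k)  = cong (_≐ k) (subT-split-raise t)

  subL-split-raise : ∀ Π → subL (split N h g) (subL (raise N) Π) ≡ subL g Π
  subL-split-raise []      = refl
  subL-split-raise (A ∷ Π) = cong₂ _∷_ (subA-split-raise A) (subL-split-raise Π)

assign : Term → Term → Term → Subst
assign a b c 0 = a
assign a b c 1 = b
assign a b c 2 = c
assign a b c _ = 𝟘

module _ {n : ℕ} where

  resolve-unit : ∀ {N A Π Δ P Π′} (h g : Subst) →
                 Derivable n ([] ⊢ (A ∷ [])) → VarsBelowₐ N A →
                 C n (Π ⊢ Δ) → Π ↭ (P ∷ Π′) → subA h A ≡ subA g P →
                 Derivable n (subL g Π′ ⊢ subL g Δ)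
  resolve-unit {N} {A} {Π} {Δ} {P} {Π′} h g ⊢A A<N ax Π↭ hA≡gP =
    subst (Derivable n) (cong₂ _⊢_ (subL-split-raise N h g Π′) (subL-split-raise N h g Δ))
      (resolve (split N h g) ⊢A axiom′ unifies)
    where
    axiom′ : Derivable n ((subA (raise N) P ∷ subL (raise N) Π′) ⊢ subL (raise N) Δ)
    axiom′ = exchange (axiom ax (N +_) (+-cancelˡ-≡ N _ _)) (map⁺ (subA (raise N)) Π↭) ↭-refl

    unifies : subA (split N h g) A ≡ subA (split N h g) (subA (raise N) P)
    unifies = trans (subA-split-below N h g A A<N)
                (trans hA≡gP (sym (subA-split-raise N h g P)))

  resolve-C3 : ∀ {N A a b T} (h : Subst) →
               Derivable n ([] ⊢ (A ∷ [])) → VarsBelowₐ N A →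
               subA h A ≡ (max a b ≤ₐ T) → Derivable n ([] ⊢ (b ≤ₐ T ∷ []))
  resolve-C3 {a = a} {b} {T} h ⊢A A<N eq =
    resolve-unit h (assign a b T) ⊢A A<N C3 ↭-refl eq

  resolve-C4 : ∀ {N A u t} (h : Subst) (i : ℕ) → i ≤ n →
               Derivable n ([] ⊢ (A ∷ [])) → VarsBelowₐ N A →
               subA h A ≡ (s u ≤ₐ t) → Derivable n ((f u ≐ i ∷ f t ≐ i ∷ []) ⊢ [])
  resolve-C4 {u = u} {t} h i i≤n ⊢A A<N eq =
    resolve-unit h (assign t u 𝟘) ⊢A A<N (C4 i i≤n) (shift _ (_ ∷ _ ∷ []) []) eq

  ⊢α≤α : Derivable n ([] ⊢ (α ≤ₐ α ∷ []))
  ⊢α≤α = axiom C1 (λ v → v) (λ eq → eq)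

  ⊢≤max : ∀ a t → Derivable n ([] ⊢ (t ≤ₐ max a t ∷ []))
  ⊢≤max a t = resolve-C3 {N = 1} (λ _ → max a t) ⊢α≤α (s≤s z≤n , s≤s z≤n) refl

  ⊢≤m : ∀ {N} k a t → k < N → VarsBelow N a → VarsBelow N t →
        Derivable n ([] ⊢ (t ≤ₐ m k (max a t) ∷ []))
  ⊢≤m zero    a t _   _   _   = ⊢≤max a t
  ⊢≤m (suc k) a t k<N a<N t<N =
    resolve-C3 {a = a} var
      (⊢≤m k (s (x (suc k))) (max a t) (<-trans (n<1+n k) k<N) k<N (a<N , t<N))
      ((a<N , t<N) , m<N) (subA-var _)
    where
    m<N : VarsBelow _ (m (suc k) (max a t))
    m<N = VarsBelow-m (suc k) (max a t) k<N (a<N , t<N)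

corollary3 : (k n i : ℕ) → i ≤ n →
    Derivable n ((f (x (suc k)) ≐ i ∷ f (m k (s (x (suc k)))) ≐ i ∷ []) ⊢ [])
corollary3 zero    n i i≤n =
  resolve-C4 {N = 1} (λ _ → s (x 1)) i i≤n ⊢α≤α (s≤s z≤n , s≤s z≤n) refl
corollary3 (suc k) n i i≤n =
  resolve-C4 var i i≤n (⊢≤m k a t k<N a<N t<N)
    (t<N , VarsBelow-m k (max a t) k<N (a<N , t<N)) (subA-var _)
  where
  a t : Term
  a = s (x (suc k))
  t = s (x (suc (suc k)))
  t<N : suc (suc k) < suc (suc (suc k))
  t<N = n<1+n _
  a<N : suc k < suc (suc (suc k))
  a<N = m<n⇒m<1+n (n<1+n _)
  k<N : k < suc (suc (suc k))
  k<N = <-trans (n<1+n k) a<N
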